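{- Let $\boldsymbol{\alpha}$ and $\boldsymbol{\beta}$ be tuples of parameters in $\mathbb{Q}\setminus\mathbb{Z}_{\le0}$, and $d=d_{\boldsymbol{\alpha},\boldsymbol{\beta}}$. There exists a constant $\mathcal{N}_{\boldsymbol{\alpha},\boldsymbol{\beta}}$ such that for all entries $\alpha,\beta$ of $\boldsymbol{\alpha}$ or $\boldsymbol{\beta}$, all primes $p$ not dividing $d$, and all integers $\ell\ge1$ with $p^\ell\ge\mathcal{N}_{\boldsymbol{\alpha},\boldsymbol{\beta}}$, $$a\alpha\preceq a\beta\iff\mathfrak{D}_p^\ell(\alpha)+\frac{\lfloor1-\alpha\rfloor}{p^\ell}\le\mathfrak{D}_p^\ell(\beta)+\frac{\lfloor1-\beta\rfloor}{p^\ell},$$ where $a\in\{1,\dots,d\}$ satisfies $p^\ell a\equiv1\bmod d$. Moreover, if all entries of $\boldsymbol{\alpha}$ and $\boldsymbol{\beta}$ lie in $(0,1]$, one can take $\mathcal{N}_{\boldsymbol{\alpha},\boldsymbol{\beta}}=1$.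
   Context: $d_{\boldsymbol{\alpha},\boldsymbol{\beta}}$ is the lcm of the exact denominators of the entries. $\underline{x}\in(0,1]$ with $x-\underline{x}\in\mathbb{Z}$. Order $\preceq$ on $\mathbb{R}$: $x\preceq y$ iff $\underline{x}<\underline{y}$ or ($\underline{x}=\underline{y}$ and $x\ge y$). For a prime $p$ and $x\in\mathbb{Q}\cap\mathbb{Z}_p$, $\mathfrak{D}_p(x)$ is the unique element of $\mathbb{Q}\cap\mathbb{Z}_p$ with $p\mathfrak{D}_p(x)-x\in\{0,\dots,p-1\}$; $\mathfrak{D}_p^\ell$ is its $\ell$-th iterate. -}

module Defs where

open import Data.Nat as ℕ using (ℕ; zero; suc; _^_; _∸_)
open import Data.Nat.Divisibility using (_∣_; _∣?_)
open import Data.Nat.LCM using (lcm)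
open import Data.Integer as ℤ using (ℤ; +_)
open import Data.Rational as ℚ using (ℚ; ↧ₙ_; floor; ceiling; _/_; _+_; _-_; _*_; _≤_; _<_; 0ℚ; 1ℚ)
open import Data.List using (List; []; _∷_; foldr; map; upTo)
open import Data.Product using (_×_)
open import Data.Sum using (_⊎_)
open import Relation.Nullary using (¬_; yes; no)
open import Relation.Binary.PropositionalEquality using (_≡_; _≢_)

ℕtoℚ : ℕ → ℚ
ℕtoℚ n = (+ n) / 1

ℤtoℚ : ℤ → ℚ
ℤtoℚ z = z / 1

-- q / n for a natural n (junk value 0 when n = 0; only used with n = p^ℓ ≥ 2)
divℕ : ℚ → ℕ → ℚ
divℕ q zero    = 0ℚ
divℕ q (suc n) = q * ((+ 1) / suc n)

dAB : List ℚ → List ℚ → ℕ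
dAB αs βs = foldr lcm 1 (map ↧ₙ_ (αs Data.List.++ βs))
  where import Data.List

NotNonPosInt : ℚ → Set
NotNonPosInt x = (n : ℕ) → x ≢ ℚ.- ℕtoℚ n

InUnit : ℚ → Set
InUnit x = (0ℚ < x) × (x ≤ 1ℚ)

-- underline x : the unique element of (0,1] with x - underline x ∈ ℤ
under : ℚ → ℚ
under x = x - ℤtoℚ (ceiling x) + 1ℚ

_⪯_ : ℚ → ℚ → Set
x ⪯ y = (under x < under y) ⊎ ((under x ≡ under y) × (y ≤ x))

InZp : ℕ → ℚ → Set
InZp p x = ¬ (p ∣ ↧ₙ x)

-- Dwork prime map 𝔇_p(x): the unique y ∈ ℚ ∩ ℤ_p with p y - x ∈ {0,…,p-1},
-- i.e. y = (x + k)/p for the unique k ∈ {0,…,p-1} making (x+k)/p p-integral.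
-- (Junk value 0 if no such k exists, which never happens for x ∈ ℚ ∩ ℤ_p.)
𝔇-search : ℕ → ℚ → List ℕ → ℚ
𝔇-search p x []       = 0ℚ
𝔇-search p x (k ∷ ks) with p ∣? ↧ₙ (divℕ (x + ℕtoℚ k) p)
... | no  _ = divℕ (x + ℕtoℚ k) p
... | yes _ = 𝔇-search p x ks

𝔇 : ℕ → ℚ → ℚ
𝔇 p x = 𝔇-search p x (upTo p)

𝔇^ : ℕ → ℕ → ℚ → ℚ
𝔇^ p zero    x = x
𝔇^ p (suc ℓ) x = 𝔇 p (𝔇^ p ℓ x)

module Submission where

-- Write every parameter over the common denominator D = d as x = X/D, and let
-- P = p^ℓ with p ∤ D.  The Dwork iterate is 𝔇_p^ℓ(x) = M/D with M·P = X + K·D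
-- and 0 ≤ K < P (DworkMap), and f = ⌊1 - x⌋ is the integer with
-- X + f·D ∈ (0, D] (Floor).  If a·P ≡ 1 (mod D) then a·X ≡ M (mod D); once
-- P > 2·|f|·D the numerator M lies in (0, D], so under(a·x) = M/D.  The right
-- hand side of the theorem is (M·P + f·D)/(D·P), and N = M·P + f·D is ordered
-- first by M and, for equal M, inversely by X (SkeletonFacts) -- which is
-- exactly how ⪯ orders a·α and a·β.  With S the sum of all |⌊1 - x⌋| this
-- works for p^ℓ ≥ 2·S·d + 1; for parameters in (0, 1] every correction
-- vanishes, so S = 0 and the threshold is 1.

open import Defs
open import Data.Nat as ℕ using (ℕ; zero; suc; _^_; _∸_)
import Data.Nat.Properties as ℕP
open import Data.Nat.Divisibility using (_∣_; divides; _∣?_; ∣-trans)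
open import Data.Nat.LCM using (lcm; m∣lcm[m,n]; n∣lcm[m,n])
open import Data.Nat.Primality using (Prime; euclidsLemma; prime⇒irreducible; prime⇒nonZero)
open import Data.Nat.Coprimality using (Coprime; coprime-Bézout)
open import Data.Nat.GCD as ℕG using (module Bézout)
open import Data.Integer as ℤ using (ℤ; +_; +[1+_]; -[1+_])
import Data.Integer.Properties as ℤP
import Data.Integer.DivMod as ℤD
open import Data.Integer.Tactic.RingSolver using (solve-∀)
open import Data.Rational as ℚ using (ℚ; mkℚ; _/_; toℚᵘ; floor; ↥_; ↧_; ↧ₙ_; 1ℚ)
import Data.Rational.Properties as ℚP
open import Data.Rational.Unnormalised as ℚᵘ using (mkℚᵘ; *≡*; *≤*; *<*)
import Data.Rational.Unnormalised.Properties as ℚᵘP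
open import Data.List using (List; []; _∷_; _++_; foldr; map; upTo)
open import Data.List.Relation.Unary.All using (All; lookup)
open import Data.List.Relation.Unary.All.Properties using (++⁺)
open import Data.List.Membership.Propositional using (_∈_)
open import Data.List.Membership.Propositional.Properties using (∈-upTo⁺; ∈-upTo⁻)
open import Data.List.Relation.Unary.Any using (here; there)
open import Data.Product using (Σ; _×_; _,_; proj₁; proj₂)
open import Data.Sum using (inj₁; inj₂)
open import Data.Empty using (⊥; ⊥-elim)
open import Function.Bundles using (_⇔_; mk⇔; Equivalence)
open import Relation.Binary using (tri<; tri≈; tri>)
open import Relation.Binary.PropositionalEquality
open import Relation.Nullary using (¬_; yes; no)

module Fraction where

  private
    unnormalise : ∀ A b → toℚᵘ (A / suc b) ℚᵘ.≃ mkℚᵘ A b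
    unnormalise A b = ℚP.toℚᵘ-fromℚᵘ (mkℚᵘ A b)

  cross-≤⇒ : ∀ {A C} b e → A / suc b ℚ.≤ C / suc e → A ℤ.* +[1+ e ] ℤ.≤ C ℤ.* +[1+ b ]
  cross-≤⇒ {A} {C} b e le
    with ℚᵘP.≤-respˡ-≃ (unnormalise A b) (ℚᵘP.≤-respʳ-≃ (unnormalise C e) (ℚP.toℚᵘ-mono-≤ le))
  ... | *≤* h = h

  cross-≤⇐ : ∀ {A C} b e → A ℤ.* +[1+ e ] ℤ.≤ C ℤ.* +[1+ b ] → A / suc b ℚ.≤ C / suc e
  cross-≤⇐ {A} {C} b e h = ℚP.toℚᵘ-cancel-≤
    (ℚᵘP.≤-respˡ-≃ (ℚᵘP.≃-sym (unnormalise A b)) (ℚᵘP.≤-respʳ-≃ (ℚᵘP.≃-sym (unnormalise C e)) (*≤* h)))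

  cross-<⇒ : ∀ {A C} b e → A / suc b ℚ.< C / suc e → A ℤ.* +[1+ e ] ℤ.< C ℤ.* +[1+ b ]
  cross-<⇒ {A} {C} b e lt
    with ℚᵘP.<-respˡ-≃ (unnormalise A b) (ℚᵘP.<-respʳ-≃ (unnormalise C e) (ℚP.toℚᵘ-mono-< lt))
  ... | *<* h = h

  cross-<⇐ : ∀ {A C} b e → A ℤ.* +[1+ e ] ℤ.< C ℤ.* +[1+ b ] → A / suc b ℚ.< C / suc e
  cross-<⇐ {A} {C} b e h = ℚP.toℚᵘ-cancel-<
    (ℚᵘP.<-respˡ-≃ (ℚᵘP.≃-sym (unnormalise A b)) (ℚᵘP.<-respʳ-≃ (ℚᵘP.≃-sym (unnormalise C e)) (*<* h)))

  cross-≡⇒ : ∀ {A C} b e → A / suc b ≡ C / suc e → A ℤ.* +[1+ e ] ≡ C ℤ.* +[1+ b ]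
  cross-≡⇒ {A} {C} b e eq
    with ℚᵘP.≃-trans (ℚᵘP.≃-sym (unnormalise A b))
           (ℚᵘP.≃-trans (ℚᵘP.≃-reflexive (cong toℚᵘ eq)) (unnormalise C e))
  ... | *≡* h = h

  cross-≡⇐ : ∀ {A C} b e → A ℤ.* +[1+ e ] ≡ C ℤ.* +[1+ b ] → A / suc b ≡ C / suc e
  cross-≡⇐ {A} {C} b e h = ℚP.fromℚᵘ-cong {mkℚᵘ A b} {mkℚᵘ C e} (*≡* h)

  /-+ : ∀ A b C e → A / suc b ℚ.+ C / suc e ≡ (A ℤ.* +[1+ e ] ℤ.+ C ℤ.* +[1+ b ]) / (suc b ℕ.* suc e)
  /-+ A b C e = ℚP.toℚᵘ-injective (ℚᵘP.≃-trans (ℚP.toℚᵘ-homo-+ (A / suc b) (C / suc e))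
    (ℚᵘP.≃-trans (ℚᵘP.+-cong (unnormalise A b) (unnormalise C e)) (ℚᵘP.≃-sym (unnormalise _ _))))

  /-* : ∀ A b C e → (A / suc b) ℚ.* (C / suc e) ≡ (A ℤ.* C) / (suc b ℕ.* suc e)
  /-* A b C e = ℚP.toℚᵘ-injective (ℚᵘP.≃-trans (ℚP.toℚᵘ-homo-* (A / suc b) (C / suc e))
    (ℚᵘP.≃-trans (ℚᵘP.*-cong (unnormalise A b) (unnormalise C e)) (ℚᵘP.≃-sym (unnormalise _ _))))

  /-neg : ∀ A b → ℚ.- (A / suc b) ≡ (ℤ.- A) / suc b
  /-neg A b = ℚP.toℚᵘ-injective (ℚᵘP.≃-trans (ℚP.toℚᵘ-homo‿- (A / suc b))
    (ℚᵘP.≃-trans (ℚᵘP.-‿cong (unnormalise A b)) (ℚᵘP.≃-sym (unnormalise _ _))))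

  same-den-≤ : ∀ A C b → (A / suc b ℚ.≤ C / suc b) ⇔ (A ℤ.≤ C)
  same-den-≤ A C b = mk⇔
    (λ h → ℤP.*-cancelʳ-≤-pos A C +[1+ b ] (cross-≤⇒ {A} {C} b b h))
    (λ h → cross-≤⇐ {A} {C} b b (ℤP.*-monoʳ-≤-nonNeg +[1+ b ] h))

  same-den-< : ∀ A C b → (A / suc b ℚ.< C / suc b) ⇔ (A ℤ.< C)
  same-den-< A C b = mk⇔
    (λ h → ℤP.*-cancelʳ-<-nonNeg +[1+ b ] (cross-<⇒ {A} {C} b b h))
    (λ h → cross-<⇐ {A} {C} b b (ℤP.*-monoʳ-<-pos +[1+ b ] h))

  same-den-≡ : ∀ A C b → (A / suc b ≡ C / suc b) ⇔ (A ≡ C)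
  same-den-≡ A C b = mk⇔
    (λ h → ℤP.*-cancelʳ-≡ A C +[1+ b ] (cross-≡⇒ {A} {C} b b h))
    (cong (_/ suc b))

-- Linear integer facts are proved by certificates: the slack of the wanted
-- inequality is exhibited as a sum of manifestly nonnegative terms, and a
-- contradiction as a nonnegative quantity equal to -1; the identity behind
-- each certificate is checked by the ring solver.
module Certificate where

  open import Data.Integer using (_+_; _*_; _-_; _≤_; _<_)

  ≤⇒slack : ∀ {i j} → i ≤ j → + 0 ≤ j - i
  ≤⇒slack = ℤP.i≤j⇒0≤j-i

  slack⇒≤ : ∀ {i j} → + 0 ≤ j - i → i ≤ j
  slack⇒≤ = ℤP.0≤i-j⇒j≤i

  <⇒slack : ∀ {i j} → i < j → + 0 ≤ j - i - + 1
  <⇒slack {i} {j} h = subst (+ 0 ≤_) (shift i j) (≤⇒slack (ℤP.i<j⇒suc[i]≤j h))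
    where shift : ∀ i j → j - (+ 1 + i) ≡ j - i - + 1
          shift = solve-∀

  slack⇒< : ∀ {i j} → + 0 ≤ j - i - + 1 → i < j
  slack⇒< {i} {j} h = ℤP.suc[i]≤j⇒i<j (slack⇒≤ (subst (+ 0 ≤_) (shift i j) h))
    where shift : ∀ i j → j - i - + 1 ≡ j - (+ 1 + i)
          shift = solve-∀

  0≤+ : ∀ {a b} → + 0 ≤ a → + 0 ≤ b → + 0 ≤ a + b
  0≤+ = ℤP.+-mono-≤

  0≤* : ∀ {a b} → + 0 ≤ a → + 0 ≤ b → + 0 ≤ a * b
  0≤* {+ n} {b} (ℤ.+≤+ _) h = subst (_≤ + n * b) (ℤP.*-zeroʳ (+ n)) (ℤP.*-monoˡ-≤-nonNeg (+ n) h)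

  0≤ℕ : ∀ n → + 0 ≤ + n
  0≤ℕ n = ℤ.+≤+ ℕ.z≤n

  0≤-≡ : ∀ {a b} → + 0 ≤ a → a ≡ b → + 0 ≤ b
  0≤-≡ h refl = h

  nonneg≢-1 : ∀ {a} → + 0 ≤ a → a + + 1 ≡ + 0 → ⊥
  nonneg≢-1 {a} h e = ℤP.<-irrefl (sym e)
    (ℤP.≤-<-trans h (subst (a <_) (ℤP.+-comm (+ 1) a) (ℤP.suc[i]≤j⇒i<j ℤP.≤-refl)))

open Certificate

rep-unique : ∀ t V W D → + 0 ℤ.< V → V ℤ.≤ D → + 0 ℤ.< W → W ℤ.≤ D → V ≡ W ℤ.+ t ℤ.* D → t ≡ + 0
rep-unique (+ zero) V W D _ _ _ _ _ = refl
rep-unique +[1+ n ] .(W ℤ.+ +[1+ n ] ℤ.* D) W D V>0 V≤D W>0 W≤D refl =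
  ⊥-elim (nonneg≢-1 (0≤+ (0≤+ (≤⇒slack V≤D) (<⇒slack W>0)) (0≤* (0≤ℕ n) 0≤D)) (certificate W D (+ n)))
  where
  open import Data.Integer using (_+_; _*_; _-_)
  0≤D = ℤP.<⇒≤ (ℤP.<-≤-trans W>0 W≤D)
  certificate : ∀ W D N → (D - (W + (+ 1 + N) * D)) + (W - + 0 - + 1) + N * D + + 1 ≡ + 0
  certificate = solve-∀
rep-unique -[1+ n ] .(W ℤ.+ -[1+ n ] ℤ.* D) W D V>0 V≤D W>0 W≤D refl =
  ⊥-elim (nonneg≢-1 (0≤+ (0≤+ (<⇒slack V>0) (≤⇒slack W≤D)) (0≤* (0≤ℕ n) 0≤D)) (certificate W D (+ n)))
  where
  open import Data.Integer using (_+_; _*_; _-_; -_)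
  0≤D = ℤP.<⇒≤ (ℤP.<-≤-trans W>0 W≤D)
  certificate : ∀ W D N → (W + (- (+ 1 + N)) * D - + 0 - + 1) + (D - W) + N * D + + 1 ≡ + 0
  certificate = solve-∀

module Floor where

  open import Data.Integer using (_+_; _*_; _-_; -_; _≤_; _<_)
  open Fraction

  -- ⌊t⌋ is the Euclidean quotient of the reduced numerator by the denominator.
  floor-bounds-reduced : ∀ t → floor t * ↧ t ≤ ↥ t × ↥ t < (floor t + + 1) * ↧ t
  floor-bounds-reduced (mkℚ n d-1 _) = lower , upper
    where
    D = +[1+ d-1 ]
    q = n ℤD./ D
    r = n ℤD.% D
    euclid : n ≡ + r + q * D
    euclid = ℤD.a≡a%n+[a/n]*n n D
    lower : q * D ≤ n
    lower = ℤP.≤-trans (ℤP.i≤j+i (q * D) (+ r)) (ℤP.≤-reflexive (sym euclid))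
    upper : n < (q + + 1) * D
    upper = subst (_< (q + + 1) * D) (sym euclid)
              (subst (λ z → + r + q * D < z) (distrib q D) (ℤP.+-monoˡ-< (q * D) (ℤ.+<+ (ℤD.n%d<d n D))))
      where distrib : ∀ q D → D + q * D ≡ (q + + 1) * D
            distrib = solve-∀

  floor-bounds : ∀ t A e → t ≡ A / suc e → floor t * +[1+ e ] ≤ A × A < (floor t + + 1) * +[1+ e ]
  floor-bounds t@(mkℚ n d-1 _) A e t≡ = lower , upper
    where
    E = +[1+ e ]
    D = +[1+ d-1 ]
    rescale : n * E ≡ A * D
    rescale = cross-≡⇒ {n} {A} d-1 e (trans (ℚP.↥p/↧p≡p t) t≡)
    swap : ∀ a b c → a * b * c ≡ a * c * b
    swap = solve-∀
    lower : floor t * E ≤ A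
    lower = ℤP.*-cancelʳ-≤-pos (floor t * E) A D
      (subst₂ _≤_ (swap (floor t) D E) rescale (ℤP.*-monoʳ-≤-nonNeg E (proj₁ (floor-bounds-reduced t))))
    upper : A < (floor t + + 1) * E
    upper = ℤP.*-cancelʳ-<-nonNeg D
      (subst₂ _<_ rescale (swap (floor t + + 1) D E) (ℤP.*-monoʳ-<-pos E (proj₂ (floor-bounds-reduced t))))

  -- The representative in (0,1]: if q = Q/(1+e) and Q = R + z·(1+e) with
  -- R ∈ (0, 1+e], then under q = R/(1+e).  The ceiling of q is pinned down by
  -- the floor bounds for -q together with rep-unique.
  under-rep : ∀ q (Q R z : ℤ) (e : ℕ) → q ≡ Q / suc e → Q ≡ R + z * +[1+ e ] →
              + 0 < R → R ≤ +[1+ e ] → under q ≡ R / suc e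
  under-rep q Q R z e q≡ refl R>0 R≤E = begin
    q ℚ.- ℤtoℚ (ℚ.ceiling q) ℚ.+ ℚ.1ℚ
      ≡⟨ cong₂ (λ u v → u ℚ.- ℤtoℚ v ℚ.+ ℚ.1ℚ) q≡ ceiling≡ ⟩
    Q / suc e ℚ.+ ℚ.- ((+ 1 + z) / 1) ℚ.+ (+ 1 / 1)
      ≡⟨ cong (λ u → Q / suc e ℚ.+ u ℚ.+ (+ 1 / 1)) (/-neg (+ 1 + z) 0) ⟩
    Q / suc e ℚ.+ (- (+ 1 + z)) / 1 ℚ.+ (+ 1 / 1)
      ≡⟨ cong (ℚ._+ (+ 1 / 1)) (/-+ Q e (- (+ 1 + z)) 0) ⟩
    N / suc (e ℕ.* 1) ℚ.+ (+ 1 / 1)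
      ≡⟨ /-+ N (e ℕ.* 1) (+ 1) 0 ⟩
    (N * + 1 + + 1 * +[1+ e ℕ.* 1 ]) / suc ((e ℕ.* 1) ℕ.* 1)
      ≡⟨ cross-≡⇐ {N * + 1 + + 1 * +[1+ e ℕ.* 1 ]} {R} ((e ℕ.* 1) ℕ.* 1) e (simplify R z E) ⟩
    R / suc e ∎
    where
    open ≡-Reasoning
    E = +[1+ e ]
    N = Q * + 1 + - (+ 1 + z) * E
    fl = floor (ℚ.- q)
    bounds = floor-bounds (ℚ.- q) (- Q) e (trans (cong ℚ.-_ q≡) (/-neg Q e))
    W = E - (- Q - fl * E)
    W>0 : + 0 < W
    W>0 = slack⇒< (0≤-≡ (<⇒slack (proj₂ bounds)) (identity Q fl E))
      where identity : ∀ Q fl E → (fl + + 1) * E - - Q - + 1 ≡ E - (- Q - fl * E) - + 0 - + 1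
            identity = solve-∀
    W≤E : W ≤ E
    W≤E = slack⇒≤ (0≤-≡ (≤⇒slack (proj₁ bounds)) (identity Q fl E))
      where identity : ∀ Q fl E → - Q - fl * E ≡ E - (E - (- Q - fl * E))
            identity = solve-∀
    -- R and W are both representatives of Q modulo E in (0, E].
    offset-zero : - (+ 1) - z - fl ≡ + 0
    offset-zero = rep-unique _ R W E R>0 R≤E W>0 W≤E (identity R z fl E)
      where identity : ∀ R z fl E → R ≡ E - (- (R + z * E) - fl * E) + (- (+ 1) - z - fl) * E
            identity = solve-∀
    ceiling≡ : ℚ.ceiling q ≡ + 1 + z
    ceiling≡ = begin
      ℚ.ceiling q                       ≡⟨ ceiling-neg q ⟩
      - fl                              ≡⟨ identity z fl ⟩
      + 1 + z + (- (+ 1) - z - fl)      ≡⟨ cong (λ u → + 1 + z + u) offset-zero ⟩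
      + 1 + z + + 0                     ≡⟨ ℤP.+-identityʳ _ ⟩
      + 1 + z                           ∎
      where
      ceiling-neg : ∀ q → ℚ.ceiling q ≡ - floor (ℚ.- q)
      ceiling-neg (mkℚ _ _ _) = refl
      identity : ∀ z fl → - fl ≡ + 1 + z + (- (+ 1) - z - fl)
      identity = solve-∀
    simplify : ∀ R z E → (((R + z * E) * + 1 + - (+ 1 + z) * E) * + 1 + + 1 * (E * + 1)) * E
                         ≡ R * (E * + 1 * + 1)
    simplify = solve-∀

  shift-bounds : ∀ x X d' → x ≡ X / suc d' →
                 + 0 < X + floor (ℚ.1ℚ ℚ.- x) * +[1+ d' ] × X + floor (ℚ.1ℚ ℚ.- x) * +[1+ d' ] ≤ +[1+ d' ]
  shift-bounds x X d' x≡ =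
    slack⇒< (0≤-≡ (<⇒slack (proj₂ bounds)) (upper f D X)) , slack⇒≤ (0≤-≡ (≤⇒slack (proj₁ bounds)) (lower f D X))
    where
    D = +[1+ d' ]
    f = floor (ℚ.1ℚ ℚ.- x)
    one-minus : ℚ.1ℚ ℚ.- x ≡ (D - X) / suc d'
    one-minus = begin
      (+ 1 / 1) ℚ.+ ℚ.- x              ≡⟨ cong (λ u → (+ 1 / 1) ℚ.+ ℚ.- u) x≡ ⟩
      (+ 1 / 1) ℚ.+ ℚ.- (X / suc d')   ≡⟨ cong ((+ 1 / 1) ℚ.+_) (/-neg X d') ⟩
      (+ 1 / 1) ℚ.+ (- X) / suc d'     ≡⟨ /-+ (+ 1) 0 (- X) d' ⟩
      (+ 1 * D + - X * + 1) / suc (d' ℕ.+ 0)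
        ≡⟨ cross-≡⇐ {+ 1 * D + - X * + 1} {D - X} (d' ℕ.+ 0) d' (identity X D) ⟩
      (D - X) / suc d'                 ∎
      where
      open ≡-Reasoning
      identity : ∀ X D → (+ 1 * D + - X * + 1) * D ≡ (D - X) * (+ 1 * D)
      identity = solve-∀
    bounds = floor-bounds (ℚ.1ℚ ℚ.- x) (D - X) d' one-minus
    upper : ∀ f D X → (f + + 1) * D - (D - X) - + 1 ≡ X + f * D - + 0 - + 1
    upper = solve-∀
    lower : ∀ f D X → D - X - f * D ≡ D - (X + f * D)
    lower = solve-∀

  -- For x ∈ (0, 1] the correction ⌊1 - x⌋ vanishes: X and X + ⌊1-x⌋·D are
  -- both representatives in (0, D] of the same class.
  unit⇒floor≡0 : ∀ x → InUnit x → floor (ℚ.1ℚ ℚ.- x) ≡ + 0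
  unit⇒floor≡0 x (x>0 , x≤1) =
    rep-unique (floor (ℚ.1ℚ ℚ.- x)) _ X D (proj₁ shifted) (proj₂ shifted) X>0 X≤D refl
    where
    X = ↥ x
    e = ℚ.denominator-1 x
    D = +[1+ e ]
    x≡ : x ≡ X / suc e
    x≡ = sym (ℚP.↥p/↧p≡p x)
    shifted = shift-bounds x X e x≡
    X>0 : + 0 < X
    X>0 = subst (+ 0 <_) (ℤP.*-identityʳ X) (cross-<⇒ {+ 0} {X} 0 e (subst (ℚ.0ℚ ℚ.<_) x≡ x>0))
    X≤D : X ≤ D
    X≤D = subst₂ _≤_ (ℤP.*-identityʳ X) (ℤP.*-identityˡ D) (cross-≤⇒ {X} {+ 1} e 0 (subst (ℚ._≤ ℚ.1ℚ) x≡ x≤1))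

-- The integer skeleton of one parameter x = X/D, with P = p^ℓ:
-- the ℓ-th Dwork iterate is M/D with M·P = X + K·D and 0 ≤ K < P,
-- M ≠ 0, f = ⌊1 - x⌋ is characterised by X + f·D ∈ (0, D], and |f·D| ≤ E.
record Skeleton (P D E M K f X : ℤ) : Set where
  field
    X≡       : X ≡ M ℤ.* P ℤ.- K ℤ.* D
    K≥0      : + 0 ℤ.≤ K
    K<P      : K ℤ.< P
    shift>0  : + 0 ℤ.< X ℤ.+ f ℤ.* D
    shift≤D  : X ℤ.+ f ℤ.* D ℤ.≤ D
    M≢0      : M ≢ + 0
    -E≤fD    : ℤ.- E ℤ.≤ f ℤ.* D
    fD≤E     : f ℤ.* D ℤ.≤ E

module SkeletonFacts {P D E : ℤ} (D>0 : + 0 ℤ.< D) (E≥0 : + 0 ℤ.≤ E) (2E<P : E ℤ.+ E ℤ.< P) where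

  open import Data.Integer using (_+_; _*_; _-_; -_; _≤_; _<_)
  open Skeleton

  private
    0≤D = ℤP.<⇒≤ D>0
    0≤P : ∀ {M K f X} → Skeleton P D E M K f X → + 0 ≤ P
    0≤P s = ℤP.<⇒≤ (ℤP.≤-<-trans (K≥0 s) (K<P s))

  -- M < 0 would force X + f·D ≤ -P + E < 0.
  numerator>0 : ∀ {M K f X} → Skeleton P D E M K f X → + 0 < M
  numerator>0 {M} {K} {f} {X} s with ℤP.<-cmp (+ 0) M
  ... | tri< 0<M _ _ = 0<M
  ... | tri≈ _ 0≡M _ = ⊥-elim (M≢0 s (sym 0≡M))
  ... | tri> _ _ M<0 with X≡ s
  ... | refl = ⊥-elim (nonneg≢-1
        (0≤+ (0≤+ (0≤+ (0≤+ (0≤+ (0≤+ (<⇒slack (shift>0 s)) (≤⇒slack (fD≤E s))) (<⇒slack 2E<P))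
           (0≤* (<⇒slack M<0) (0≤P s))) (0≤* (K≥0 s) 0≤D)) E≥0) (0≤ℕ 1))
        (certificate M K f E P D))
    where
    certificate : ∀ M K f E P D → ((M * P - K * D + f * D - + 0 - + 1) + (E - f * D) + (P - (E + E) - + 1)
                    + (+ 0 - M - + 1) * P + K * D + E + + 1) + + 1 ≡ + 0
    certificate = solve-∀

  -- M > D would force X + f·D ≥ (D+1)·P - (P-1)·D - E > D.
  numerator≤D : ∀ {M K f X} → Skeleton P D E M K f X → M ≤ D
  numerator≤D {M} {K} {f} {X} s with ℤP.<-cmp D M
  ... | tri≈ _ D≡M _ = ℤP.≤-reflexive (sym D≡M)
  ... | tri> _ _ M<D = ℤP.<⇒≤ M<D
  ... | tri< D<M _ _ with X≡ s
  ... | refl = ⊥-elim (nonneg≢-1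
        (0≤+ (0≤+ (0≤+ (0≤+ (0≤+ (≤⇒slack (shift≤D s)) (0≤* (<⇒slack (K<P s)) 0≤D))
           (≤⇒slack (-E≤fD s))) (<⇒slack 2E<P)) (0≤* (<⇒slack D<M) (0≤P s))) E≥0)
        (certificate M K f E P D))
    where
    certificate : ∀ M K f E P D → ((D - (M * P - K * D + f * D)) + (P - K - + 1) * D + (f * D - (- E))
                    + (P - (E + E) - + 1) + (M - D - + 1) * P + E) + + 1 ≡ + 0
    certificate = solve-∀

  -- Distinct numerators: the gap of at least P dominates the corrections.
  key-strict : ∀ {Mx Kx fx Xx My Ky fy Xy} → Skeleton P D E Mx Kx fx Xx → Skeleton P D E My Ky fy Xy →
               Mx < My → Mx * P + fx * D < My * P + fy * D
  key-strict {Mx} {Kx} {fx} {Xx} {My} {Ky} {fy} {Xy} sx sy Mx<My =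
    slack⇒< (0≤-≡ (0≤+ (0≤+ (0≤+ (<⇒slack 2E<P) (≤⇒slack (-E≤fD sy))) (≤⇒slack (fD≤E sx)))
                    (0≤* (<⇒slack Mx<My) (0≤P sx)))
                  (certificate Mx fx My fy E P D))
    where
    certificate : ∀ Mx fx My fy E P D → (P - (E + E) - + 1) + (fy * D - (- E)) + (E - fx * D) + (My - Mx - + 1) * P
                    ≡ My * P + fy * D - (Mx * P + fx * D) - + 1
    certificate = solve-∀

  -- Equal numerators: X + f·D ≡ M·P (mod D) and both shifts lie in (0, D], so
  -- they are equal; hence fy - fx = (Xx - Xy)/D and the orders agree.
  key-tie : ∀ {M Kx fx Xx Ky fy Xy} → Skeleton P D E M Kx fx Xx → Skeleton P D E M Ky fy Xy →
            (M * P + fx * D ≤ M * P + fy * D) ⇔ (Xy ≤ Xx)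
  key-tie {M} {Kx} {fx} {Xx} {Ky} {fy} {Xy} sx sy = go (X≡ sx) (X≡ sy)
    where
    go : Xx ≡ M * P - Kx * D → Xy ≡ M * P - Ky * D → (M * P + fx * D ≤ M * P + fy * D) ⇔ (Xy ≤ Xx)
    go refl refl = mk⇔ to from
      where
      t = Ky - Kx + fx - fy
      congruent : ∀ M P Kx Ky fx fy D →
                  M * P - Kx * D + fx * D ≡ (M * P - Ky * D + fy * D) + (Ky - Kx + fx - fy) * D
      congruent = solve-∀
      t≡0 : t ≡ + 0
      t≡0 = rep-unique t _ _ D (shift>0 sx) (shift≤D sx) (shift>0 sy) (shift≤D sy) (congruent M P Kx Ky fx fy D)
      0≤tD : + 0 ≤ t * D
      0≤tD = subst (λ u → + 0 ≤ u * D) (sym t≡0) (0≤ℕ 0)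
      0≤-tD : + 0 ≤ - (t * D)
      0≤-tD = subst (λ u → + 0 ≤ - (u * D)) (sym t≡0) (0≤ℕ 0)
      to : M * P + fx * D ≤ M * P + fy * D → Xy ≤ Xx
      to h = slack⇒≤ (0≤-≡ (0≤+ (≤⇒slack h) 0≤tD) (identity M P Kx Ky fx fy D))
        where identity : ∀ M P Kx Ky fx fy D → (M * P + fy * D - (M * P + fx * D)) + (Ky - Kx + fx - fy) * D
                           ≡ (M * P - Kx * D) - (M * P - Ky * D)
              identity = solve-∀
      from : Xy ≤ Xx → M * P + fx * D ≤ M * P + fy * D
      from h = slack⇒≤ (0≤-≡ (0≤+ (≤⇒slack h) 0≤-tD) (identity M P Kx Ky fx fy D))
        where identity : ∀ M P Kx Ky fx fy D → ((M * P - Kx * D) - (M * P - Ky * D)) + - ((Ky - Kx + fx - fy) * D)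
                           ≡ (M * P + fy * D - (M * P + fx * D))
              identity = solve-∀

den-cofactor : ∀ (W : ℤ) (n : ℕ) .{{_ : ℕ.NonZero n}} → ↧ₙ (W / n) ℕ.* ℕG.gcd ℤ.∣ W ∣ n ≡ n
den-cofactor W n = ℤP.+-injective (trans (ℤP.pos-* (↧ₙ (W / n)) (ℕG.gcd ℤ.∣ W ∣ n)) (ℚP.↧-/ W n))

den∣ : ∀ (W : ℤ) (n : ℕ) .{{_ : ℕ.NonZero n}} → ↧ₙ (W / n) ∣ n
den∣ W n = divides (ℕG.gcd ℤ.∣ W ∣ n) (trans (sym (den-cofactor W n)) (ℕP.*-comm (↧ₙ (W / n)) (ℕG.gcd ℤ.∣ W ∣ n)))

∣∣⇒factor : ∀ (c : ℤ) (p : ℕ) → p ∣ ℤ.∣ c ∣ → Σ ℤ λ W → c ≡ W ℤ.* + p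
∣∣⇒factor (+ c) p (divides q eq) = + q , trans (cong +_ eq) (ℤP.pos-* q p)
∣∣⇒factor -[1+ c ] p (divides q eq) = ℤ.- (+ q) ,
  trans (cong ℤ.-_ (trans (cong +_ eq) (ℤP.pos-* q p))) (ℤP.neg-distribˡ-* (+ q) (+ p))

module DworkMap (p' : ℕ) (p-prime : Prime (suc p')) (s' : ℕ) (p∤s : ¬ (suc p' ∣ suc s')) where

  open Fraction
  open import Data.Integer using (_+_; _*_; _-_; -_)

  p = suc p'
  s = suc s'

  s-coprime-p : Coprime s p
  s-coprime-p (i∣s , i∣p) with prime⇒irreducible p-prime i∣p
  ... | inj₁ i≡1 = i≡1
  ... | inj₂ refl = ⊥-elim (p∤s i∣s)

  private
    lift : ∀ a b c d → 1 ℕ.+ a ℕ.* b ≡ c ℕ.* d → + 1 + + a * + b ≡ + c * + d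
    lift a b c d eq = trans (cong (λ z → + 1 + z) (sym (ℤP.pos-* a b))) (trans (cong +_ eq) (ℤP.pos-* c d))

  inverse-mod-p : Σ ℤ λ t → Σ ℤ λ r → + s * t ≡ + 1 + + p * r
  inverse-mod-p with coprime-Bézout s-coprime-p
  ... | Bézout.+- x y eq = + x , + y ,
          trans (ℤP.*-comm (+ s) (+ x)) (trans (sym (lift y p x s eq)) (cong (λ z → + 1 + z) (ℤP.*-comm (+ y) (+ p))))
  ... | Bézout.-+ x y eq = - (+ x) , - (+ y) ,
          trans (negate (+ s) (+ x)) (trans (cong (λ z → + 1 - z) (lift x s y p eq)) (rearrange (+ y) (+ p)))
    where
    negate : ∀ S X → S * (- X) ≡ + 1 - (+ 1 + X * S)
    negate = solve-∀
    rearrange : ∀ Y P → + 1 - Y * P ≡ + 1 + P * (- Y)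
    rearrange = solve-∀

  DigitForm : ℤ → ℚ → Set
  DigitForm A x = Σ ℕ λ k → k ℕ.< p × Σ ℤ λ B → 𝔇 p x ≡ B / s × B * + p ≡ A + + k * + s

  IterateForm : ℕ → ℤ → ℚ → Set
  IterateForm ℓ A x = Σ ℕ λ K → K ℕ.< p ℕ.^ ℓ × Σ ℤ λ B → 𝔇^ p ℓ x ≡ B / s × B * + (p ℕ.^ ℓ) ≡ A + + K * + s

  module Step (A : ℤ) (x : ℚ) (x≡ : x ≡ A / s) where

    candidate : ℕ → ℚ
    candidate k = divℕ (x ℚ.+ ℕtoℚ k) p

    numerator : ℕ → ℤ
    numerator k = A + + k * + s

    candidate≡ : ∀ k → candidate k ≡ numerator k / (s ℕ.* p)
    candidate≡ k rewrite x≡ =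
      trans (cong (ℚ._* (+ 1 / p)) (/-+ A s' (+ k) 0))
        (trans (/-* (A * + 1 + + k * + s) (s' ℕ.* 1) (+ 1) p')
          (cross-≡⇐ {(A * + 1 + + k * + s) * + 1} {numerator k} (p' ℕ.+ (s' ℕ.* 1) ℕ.* suc p') (p' ℕ.+ s' ℕ.* suc p')
            (identity A (+ k) (+ s) (+ p))))
      where
      identity : ∀ A k S P → (A * + 1 + k * S) * + 1 * (S * P) ≡ (A + k * S) * (S * + 1 * P)
      identity = solve-∀

    -- A p-integral candidate has numerator divisible by p (p is prime and
    -- divides the unreduced denominator s·p) ...
    integral⇒p∣ : ∀ k → ¬ (p ∣ ↧ₙ (candidate k)) → p ∣ ℤ.∣ numerator k ∣
    integral⇒p∣ k integral
      with euclidsLemma (↧ₙ (numerator k / (s ℕ.* p))) (ℕG.gcd ℤ.∣ numerator k ∣ (s ℕ.* p)) p-prime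
             (subst (p ∣_) (sym (den-cofactor (numerator k) (s ℕ.* p))) (divides s refl))
    ... | inj₁ p∣den = ⊥-elim (integral (subst (λ q → p ∣ ↧ₙ q) (sym (candidate≡ k)) p∣den))
    ... | inj₂ p∣gcd = ∣-trans p∣gcd (ℕG.gcd[m,n]∣m ℤ.∣ numerator k ∣ (s ℕ.* p))

    p∣⇒integral : ∀ k W → numerator k ≡ W * + p → (candidate k ≡ W / s) × ¬ (p ∣ ↧ₙ (candidate k))
    p∣⇒integral k W eq = value , λ p∣ → p∤s (∣-trans (subst (λ q → p ∣ ↧ₙ q) value p∣) (den∣ W s))
      where
      value : candidate k ≡ W / s
      value = trans (candidate≡ k) (cross-≡⇐ {numerator k} {W} (p' ℕ.+ s' ℕ.* suc p') s'
                (trans (cong (_* + s) eq) (identity W (+ s) (+ p))))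
        where identity : ∀ W S P → W * P * S ≡ W * (S * P)
              identity = solve-∀

    -- The digit k₀ = (-A·t) mod p makes A + k₀·s divisible by p.
    good-digit : Σ ℕ λ k₀ → k₀ ℕ.< p × Σ ℤ λ W → numerator k₀ ≡ W * + p
    good-digit with inverse-mod-p
    ... | t , r , st≡ = k₀ , ℤD.n%d<d m (+ p) , W , divisible
      where
      open ≡-Reasoning
      m = - A * t
      k₀ = m ℤD.% + p
      q = m ℤD./ + p
      W = - (A * r) - q * + s
      k₀≡ : + k₀ ≡ m - q * + p
      k₀≡ = trans (cancel (+ k₀) (q * + p)) (cong (_- q * + p) (sym (ℤD.a≡a%n+[a/n]*n m (+ p))))
        where cancel : ∀ a b → a ≡ a + b - b
              cancel = solve-∀
      expand : ∀ A t q P S → A + (- A * t - q * P) * S ≡ A - A * (S * t) - q * P * S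
      expand = solve-∀
      collect : ∀ A r q P S → A - A * (+ 1 + P * r) - q * P * S ≡ (- (A * r) - q * S) * P
      collect = solve-∀
      divisible : numerator k₀ ≡ W * + p
      divisible = begin
        A + + k₀ * + s                               ≡⟨ cong (λ z → A + z * + s) k₀≡ ⟩
        A + (- A * t - q * + p) * + s                ≡⟨ expand A t q (+ p) (+ s) ⟩
        A - A * (+ s * t) - q * + p * + s            ≡⟨ cong (λ z → A - A * z - q * + p * + s) st≡ ⟩
        A - A * (+ 1 + + p * r) - q * + p * + s      ≡⟨ collect A r q (+ p) (+ s) ⟩
        W * + p                                      ∎

    search-succeeds : ∀ {k₀} ks → k₀ ∈ ks → ¬ (p ∣ ↧ₙ (candidate k₀)) →
                      Σ ℕ λ k → k ∈ ks × 𝔇-search p x ks ≡ candidate k × ¬ (p ∣ ↧ₙ (candidate k))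
    search-succeeds (k ∷ ks) k₀∈ k₀-integral with p ∣? ↧ₙ (candidate k)
    ... | no integral = k , here refl , refl , integral
    ... | yes p∣ with k₀∈
    ...   | here refl = ⊥-elim (k₀-integral p∣)
    ...   | there k₀∈ks with search-succeeds ks k₀∈ks k₀-integral
    ...     | k' , k'∈ , found , integral = k' , there k'∈ , found , integral

    dwork-step : DigitForm A x
    dwork-step = from-digit good-digit
      where
      from-search : (Σ ℕ λ k → k ∈ upTo p × 𝔇 p x ≡ candidate k × ¬ (p ∣ ↧ₙ (candidate k))) →
                    DigitForm A x
      from-search (k , k∈ , found , integral) = k , ∈-upTo⁻ k∈ , W , trans found (proj₁ (p∣⇒integral k W eq)) , sym eq
        where
        factor = ∣∣⇒factor (numerator k) p (integral⇒p∣ k integral)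
        W = proj₁ factor
        eq = proj₂ factor
      from-digit : (Σ ℕ λ k₀ → k₀ ℕ.< p × Σ ℤ λ W → numerator k₀ ≡ W * + p) →
                   DigitForm A x
      from-digit (k₀ , k₀<p , W₀ , eq₀) =
        from-search (search-succeeds (upTo p) (∈-upTo⁺ k₀<p) (proj₂ (p∣⇒integral k₀ W₀ eq₀)))

  -- Iterating: the digits k_i assemble into K = Σ k_i p^i < p^ℓ.
  dwork-iterate : ∀ ℓ (A : ℤ) x → x ≡ A / s → IterateForm ℓ A x
  dwork-iterate zero A x x≡ = 0 , ℕ.s≤s ℕ.z≤n , A , x≡ , identity A (+ s)
    where identity : ∀ A S → A * + 1 ≡ A + + 0 * S
          identity = solve-∀
  dwork-iterate (suc ℓ) A x x≡ = extend (dwork-iterate ℓ A x x≡)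
    where
    extend : IterateForm ℓ A x → IterateForm (suc ℓ) A x
    extend (K , K<P , B , 𝔇^ℓ≡ , B≡) = next (Step.dwork-step B (𝔇^ p ℓ x) 𝔇^ℓ≡)
      where
      next : DigitForm B (𝔇^ p ℓ x) → IterateForm (suc ℓ) A x
      next (k , k<p , B' , 𝔇≡ , B'≡) = K ℕ.+ k ℕ.* P , digits< , B' , 𝔇≡ , scaled
        where
        open ≡-Reasoning
        P = p ℕ.^ ℓ
        digits< : K ℕ.+ k ℕ.* P ℕ.< p ℕ.* P
        digits< = ℕP.<-≤-trans (ℕP.+-monoˡ-< (k ℕ.* P) K<P) (ℕP.*-monoˡ-≤ P k<p)
        expand : ∀ B k S P → (B + k * S) * P ≡ B * P + k * P * S
        expand = solve-∀
        collect : ∀ A K k P S → A + K * S + k * P * S ≡ A + (K + k * P) * S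
        collect = solve-∀
        scaled : B' * + (p ℕ.* P) ≡ A + + (K ℕ.+ k ℕ.* P) * + s
        scaled = begin
          B' * + (p ℕ.* P)                  ≡⟨ cong (B' *_) (ℤP.pos-* p P) ⟩
          B' * (+ p * + P)                  ≡⟨ sym (ℤP.*-assoc B' (+ p) (+ P)) ⟩
          (B' * + p) * + P                  ≡⟨ cong (_* + P) B'≡ ⟩
          (B + + k * + s) * + P             ≡⟨ expand B (+ k) (+ s) (+ P) ⟩
          B * + P + + k * + P * + s         ≡⟨ cong (_+ + k * + P * + s) B≡ ⟩
          A + + K * + s + + k * + P * + s   ≡⟨ collect A (+ K) (+ k) (+ P) (+ s) ⟩
          A + (+ K + + k * + P) * + s       ≡⟨ cong (λ z → A + (+ K + z) * + s) (sym (ℤP.pos-* k P)) ⟩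
          A + + (K ℕ.+ k ℕ.* P) * + s       ∎

corr : ℚ → ℤ
corr x = floor (1ℚ ℚ.- x)

Comparison : ℚ → ℚ → (a p ℓ P : ℕ) → Set
Comparison α β a p ℓ P =
  (ℕtoℚ a ℚ.* α) ⪯ (ℕtoℚ a ℚ.* β)
    ⇔ (𝔇^ p ℓ α ℚ.+ divℕ (ℤtoℚ (corr α)) P ℚ.≤ 𝔇^ p ℓ β ℚ.+ divℕ (ℤtoℚ (corr β)) P)

over-common-den : ∀ x d' → ↧ₙ x ∣ suc d' → Σ ℤ λ X → x ≡ X / suc d'
over-common-den x d' (divides c d≡) = ↥ x ℤ.* + c ,
  trans (sym (ℚP.↥p/↧p≡p x)) (Fraction.cross-≡⇐ {↥ x} {↥ x ℤ.* + c} (ℚ.denominator-1 x) d' (begin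
    ↥ x ℤ.* + suc d'            ≡⟨ cong (λ u → ↥ x ℤ.* + u) d≡ ⟩
    ↥ x ℤ.* + (c ℕ.* ↧ₙ x)      ≡⟨ cong (↥ x ℤ.*_) (ℤP.pos-* c (↧ₙ x)) ⟩
    ↥ x ℤ.* (+ c ℤ.* + ↧ₙ x)    ≡⟨ sym (ℤP.*-assoc (↥ x) (+ c) (+ ↧ₙ x)) ⟩
    ↥ x ℤ.* + c ℤ.* + ↧ₙ x      ∎))
  where open ≡-Reasoning

module Entries (p' d' ℓ P' : ℕ) (p-prime : Prime (suc p')) (p∤d : ¬ (suc p' ∣ suc d'))
               (p^ℓ≡ : suc p' ℕ.^ ℓ ≡ suc P') where

  open import Data.Integer using (_+_; _*_; _-_; -_; _≤_; _<_)
  open Fraction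

  p = suc p'
  D = +[1+ d' ]
  P = + suc P'

  record Entry (x : ℚ) : Set where
    field
      X M      : ℤ
      K        : ℕ
      x≡       : x ≡ X / suc d'
      iterate≡ : 𝔇^ p ℓ x ≡ M / suc d'
      M·P≡     : M * P ≡ X + + K * D
      K<P      : K ℕ.< suc P'
      M≢0      : M ≢ + 0

  -- Every parameter x ∉ ℤ_{≤0} with denominator dividing D has such data; the
  -- numerator M is nonzero since M = 0 would give x = -K.
  entry : ∀ x → NotNonPosInt x → ↧ₙ x ∣ suc d' → Entry x
  entry x x∉ℤ≤0 den∣ with over-common-den x d' den∣
  ... | X , x≡ with DworkMap.dwork-iterate p' p-prime d' p∤d ℓ X x x≡
  ... | K , K<p^ℓ , M , iterate≡ , M·p^ℓ≡ = record
    { X = X ; M = M ; K = K ; x≡ = x≡ ; iterate≡ = iterate≡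
    ; M·P≡ = M·P≡ ; K<P = subst (K ℕ.<_) p^ℓ≡ K<p^ℓ ; M≢0 = M≢0 }
    where
    M·P≡ : M * P ≡ X + + K * D
    M·P≡ = subst (λ u → M * + u ≡ X + + K * D) p^ℓ≡ M·p^ℓ≡
    M≢0 : M ≢ + 0
    M≢0 M≡0 = x∉ℤ≤0 K (trans x≡ (trans (cross-≡⇐ {X} { - (+ K)} d' 0 X≡) (sym (/-neg (+ K) 0))))
      where
      vanish : X + + K * D ≡ + 0
      vanish = trans (sym M·P≡) (cong (_* P) M≡0)
      X≡ : X * + 1 ≡ - (+ K) * D
      X≡ = trans (split X (+ K) D) (trans (cong (_- + K * D) vanish) (negate (+ K) D))
        where split : ∀ X K D → X * + 1 ≡ (X + K * D) - K * D
              split = solve-∀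
              negate : ∀ K D → + 0 - K * D ≡ - K * D
              negate = solve-∀

  skeleton : ∀ (S : ℕ) {x} (e : Entry x) → ℤ.∣ corr x ∣ ℕ.≤ S →
             let open Entry e in Skeleton P D (+ S * D) M (+ K) (corr x) X
  skeleton S {x} e bound = record
    { X≡ = trans (split X (+ K) D) (cong (_- + K * D) (sym M·P≡))
    ; K≥0 = Certificate.0≤ℕ K ; K<P = ℤ.+<+ K<P
    ; shift>0 = proj₁ shifted ; shift≤D = proj₂ shifted ; M≢0 = M≢0
    ; -E≤fD = subst (_≤ corr x * D) (sym (ℤP.neg-distribˡ-* (+ S) D))
                (ℤP.*-monoʳ-≤-nonNeg D (ℤP.≤-trans (ℤP.neg-mono-≤ (ℤ.+≤+ bound)) (-∣i∣≤i (corr x))))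
    ; fD≤E = ℤP.*-monoʳ-≤-nonNeg D (ℤP.≤-trans (i≤∣i∣ (corr x)) (ℤ.+≤+ bound)) }
    where
    open Entry e
    shifted = Floor.shift-bounds x X d' x≡
    split : ∀ X K D → X ≡ X + K * D - K * D
    split = solve-∀
    i≤∣i∣ : ∀ i → i ≤ + ℤ.∣ i ∣
    i≤∣i∣ (+ n) = ℤP.≤-refl
    i≤∣i∣ -[1+ n ] = ℤ.-≤+
    -∣i∣≤i : ∀ i → - (+ ℤ.∣ i ∣) ≤ i
    -∣i∣≤i (+ n) = ℤP.neg-≤-pos
    -∣i∣≤i -[1+ n ] = ℤP.≤-refl

  module Compare (a' c' S : ℕ) (a·P≡ : + suc a' * P ≡ + 1 + + c' * D) (2E<P : + S * D + + S * D < P) where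

    a = suc a'
    E = + S * D

    open SkeletonFacts {P} {D} {E} (ℤ.+<+ (ℕ.s≤s ℕ.z≤n)) (Certificate.0≤* (Certificate.0≤ℕ S) (Certificate.0≤ℕ (suc d')))
                       2E<P

    module Sides {x} (e : Entry x) (bound : ℤ.∣ corr x ∣ ℕ.≤ S) where

      open Entry e public
      open ≡-Reasoning

      shape : Skeleton P D E M (+ K) (corr x) X
      shape = skeleton S e bound

      scaled≡ : ℕtoℚ a ℚ.* x ≡ (+ a * X) / suc d'
      scaled≡ = trans (cong (ℕtoℚ a ℚ.*_) x≡)
        (trans (/-* (+ a) 0 X d') (cross-≡⇐ {+ a * X} {+ a * X} (d' ℕ.+ 0 ℕ.* suc d') d' (identity (+ a * X) D)))
        where identity : ∀ Y D → Y * D ≡ Y * (+ 1 * D)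
              identity = solve-∀

      -- Since a·P ≡ 1 (mod D), a·X = a·(M·P - K·D) ≡ M (mod D).
      a·X≡ : + a * X ≡ M + (+ c' * M - + a * + K) * D
      a·X≡ = begin
        + a * X                                    ≡⟨ cong (+ a *_) (Skeleton.X≡ shape) ⟩
        + a * (M * P - + K * D)                    ≡⟨ expand (+ a) M P (+ K) D ⟩
        (+ a * P) * M - + a * + K * D              ≡⟨ cong (λ u → u * M - + a * + K * D) a·P≡ ⟩
        (+ 1 + + c' * D) * M - + a * + K * D       ≡⟨ collect (+ c') M (+ a) (+ K) D ⟩
        M + (+ c' * M - + a * + K) * D             ∎
        where
        expand : ∀ a M P K D → a * (M * P - K * D) ≡ (a * P) * M - a * K * D
        expand = solve-∀
        collect : ∀ c M a K D → (+ 1 + c * D) * M - a * K * D ≡ M + (c * M - a * K) * D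
        collect = solve-∀

      under≡ : under (ℕtoℚ a ℚ.* x) ≡ M / suc d'
      under≡ = Floor.under-rep (ℕtoℚ a ℚ.* x) (+ a * X) M (+ c' * M - + a * + K) d' scaled≡ a·X≡
                 (numerator>0 shape) (numerator≤D shape)

      N : ℤ
      N = M * P + corr x * D

      rhs≡ : 𝔇^ p ℓ x ℚ.+ divℕ (ℤtoℚ (corr x)) (suc P') ≡ N / (suc d' ℕ.* suc P')
      rhs≡ = trans (cong₂ ℚ._+_ iterate≡ (/-* (corr x) 0 (+ 1) P'))
        (trans (/-+ M d' (corr x * + 1) (P' ℕ.+ 0 ℕ.* suc P'))
          (cross-≡⇐ {M * (+ 1 * P) + (corr x * + 1) * D} {N} _ (P' ℕ.+ d' ℕ.* suc P') (identity M P (corr x) D)))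
        where identity : ∀ M P f D → (M * (+ 1 * P) + (f * + 1) * D) * (D * P) ≡ (M * P + f * D) * (D * (+ 1 * P))
              identity = solve-∀

    -- The theorem for two bounded parameters: ⪯ compares first M (the
    -- representative of a·x) and on ties reverses the order of X; the key
    -- quantity N does the same by key-strict and key-tie.
    compare : ∀ {x y} (ex : Entry x) (ey : Entry y) → ℤ.∣ corr x ∣ ℕ.≤ S → ℤ.∣ corr y ∣ ℕ.≤ S →
              Comparison x y a p ℓ (suc P')
    compare {x} {y} ex ey bx by = mk⇔ to from
      where
      module X = Sides ex bx
      module Y = Sides ey by
      DP' = P' ℕ.+ d' ℕ.* suc P'

      under-< : (under (ℕtoℚ a ℚ.* x) ℚ.< under (ℕtoℚ a ℚ.* y)) ⇔ (X.M < Y.M)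
      under-< = subst₂ (λ u v → (u ℚ.< v) ⇔ (X.M < Y.M)) (sym X.under≡) (sym Y.under≡) (same-den-< X.M Y.M d')

      under-≡ : (under (ℕtoℚ a ℚ.* x) ≡ under (ℕtoℚ a ℚ.* y)) ⇔ (X.M ≡ Y.M)
      under-≡ = subst₂ (λ u v → (u ≡ v) ⇔ (X.M ≡ Y.M)) (sym X.under≡) (sym Y.under≡) (same-den-≡ X.M Y.M d')

      scaled-≤ : (ℕtoℚ a ℚ.* y ℚ.≤ ℕtoℚ a ℚ.* x) ⇔ (Y.X ≤ X.X)
      scaled-≤ = mk⇔
        (λ h → ℤP.*-cancelˡ-≤-pos Y.X X.X (+ a) (Equivalence.to numerators (subst₂ ℚ._≤_ Y.scaled≡ X.scaled≡ h)))
        (λ h → subst₂ ℚ._≤_ (sym Y.scaled≡) (sym X.scaled≡) (Equivalence.from numerators (ℤP.*-monoˡ-≤-nonNeg (+ a) h)))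
        where numerators = same-den-≤ (+ a * Y.X) (+ a * X.X) d'

      rhs-≤ : (𝔇^ p ℓ x ℚ.+ divℕ (ℤtoℚ (corr x)) (suc P') ℚ.≤ 𝔇^ p ℓ y ℚ.+ divℕ (ℤtoℚ (corr y)) (suc P'))
              ⇔ (X.N ≤ Y.N)
      rhs-≤ = subst₂ (λ u v → (u ℚ.≤ v) ⇔ (X.N ≤ Y.N)) (sym X.rhs≡) (sym Y.rhs≡) (same-den-≤ X.N Y.N DP')

      tie : X.M ≡ Y.M → (X.N ≤ Y.N) ⇔ (Y.X ≤ X.X)
      tie M≡ = subst (λ m → (X.N ≤ m * P + corr y * D) ⇔ (Y.X ≤ X.X)) M≡
                 (key-tie X.shape (subst (λ m → Skeleton P D E m (+ Y.K) (corr y) Y.X) (sym M≡) Y.shape))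

      to : (ℕtoℚ a ℚ.* x) ⪯ (ℕtoℚ a ℚ.* y) → _
      to (inj₁ lt) = Equivalence.from rhs-≤ (ℤP.<⇒≤ (key-strict X.shape Y.shape (Equivalence.to under-< lt)))
      to (inj₂ (eq , le)) =
        Equivalence.from rhs-≤ (Equivalence.from (tie (Equivalence.to under-≡ eq)) (Equivalence.to scaled-≤ le))

      from : _ → (ℕtoℚ a ℚ.* x) ⪯ (ℕtoℚ a ℚ.* y)
      from h with ℤP.<-cmp X.M Y.M
      ... | tri< lt _ _ = inj₁ (Equivalence.from under-< lt)
      ... | tri≈ _ eq _ = inj₂ (Equivalence.from under-≡ eq ,
                                Equivalence.from scaled-≤ (Equivalence.to (tie eq) (Equivalence.to rhs-≤ h)))
      ... | tri> _ _ gt = ⊥-elim (ℤP.<⇒≱ (key-strict Y.shape X.shape gt) (Equivalence.to rhs-≤ h))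

pow-suc : ∀ p' ℓ → Σ ℕ λ P' → suc p' ℕ.^ ℓ ≡ suc P'
pow-suc p' zero = 0 , refl
pow-suc p' (suc ℓ) with pow-suc p' ℓ
... | P' , p^ℓ≡ = P' ℕ.+ p' ℕ.* suc P' , cong (suc p' ℕ.*_) p^ℓ≡

comparison : ∀ d S α β → NotNonPosInt α → NotNonPosInt β → ↧ₙ α ∣ d → ↧ₙ β ∣ d →
             ℤ.∣ corr α ∣ ℕ.≤ S → ℤ.∣ corr β ∣ ℕ.≤ S →
             ∀ p → Prime p → ¬ (p ∣ d) → ∀ ℓ → suc (S ℕ.* d ℕ.+ S ℕ.* d) ℕ.≤ p ℕ.^ ℓ →
             ∀ a → 1 ℕ.≤ a → a ℕ.≤ d → d ∣ (p ℕ.^ ℓ ℕ.* a ℕ.∸ 1) → Comparison α β a p ℓ (p ℕ.^ ℓ)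
comparison zero _ _ _ _ _ _ _ _ _ _ _ _ _ _ (suc _) _ () _
comparison _ _ _ _ _ _ _ _ _ _ zero p-prime _ _ _ _ _ _ _ = ⊥-elim (ℕ.NonZero.nonZero (prime⇒nonZero p-prime))
comparison (suc d') S α β α∉ β∉ α∣ β∣ α-bound β-bound (suc p') p-prime p∤d ℓ large (suc a') _ _ (divides c' d∣)
  with pow-suc p' ℓ
... | P' , p^ℓ≡ rewrite p^ℓ≡ =
  Compare.compare a' c' S a·P≡ 2E<P (entry α α∉ α∣) (entry β β∉ β∣) α-bound β-bound
  where
  open Entries p' d' ℓ P' p-prime p∤d p^ℓ≡
  a·P≡ : + suc a' ℤ.* + suc P' ≡ + 1 ℤ.+ + c' ℤ.* +[1+ d' ]
  a·P≡ = begin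
    + suc a' ℤ.* + suc P'             ≡⟨ sym (ℤP.pos-* (suc a') (suc P')) ⟩
    + (suc a' ℕ.* suc P')             ≡⟨ cong +_ (ℕP.*-comm (suc a') (suc P')) ⟩
    + suc (suc P' ℕ.* suc a' ℕ.∸ 1)   ≡⟨ cong (λ n → + suc n) d∣ ⟩
    + 1 ℤ.+ + (c' ℕ.* suc d')         ≡⟨ cong (λ z → + 1 ℤ.+ z) (ℤP.pos-* c' (suc d')) ⟩
    + 1 ℤ.+ + c' ℤ.* +[1+ d' ]        ∎
    where open ≡-Reasoning
  2E<P : + S ℤ.* +[1+ d' ] ℤ.+ + S ℤ.* +[1+ d' ] ℤ.< + suc P'
  2E<P = subst (λ u → u ℤ.+ u ℤ.< + suc P') (ℤP.pos-* S (suc d')) (ℤ.+<+ large)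

den∣lcm : ∀ {x} xs → x ∈ xs → ↧ₙ x ∣ foldr lcm 1 (map ↧ₙ_ xs)
den∣lcm (x ∷ xs) (here refl) = m∣lcm[m,n] (↧ₙ x) (foldr lcm 1 (map ↧ₙ_ xs))
den∣lcm (y ∷ xs) (there x∈) = ∣-trans (den∣lcm xs x∈) (n∣lcm[m,n] (↧ₙ y) (foldr lcm 1 (map ↧ₙ_ xs)))

corr-total : List ℚ → ℕ
corr-total [] = 0
corr-total (x ∷ xs) = ℤ.∣ corr x ∣ ℕ.+ corr-total xs

corr≤total : ∀ {x} xs → x ∈ xs → ℤ.∣ corr x ∣ ℕ.≤ corr-total xs
corr≤total (x ∷ xs) (here refl) = ℕP.m≤m+n (ℤ.∣ corr x ∣) (corr-total xs)
corr≤total (y ∷ xs) (there x∈) = ℕP.≤-trans (corr≤total xs x∈) (ℕP.m≤n+m (corr-total xs) (ℤ.∣ corr y ∣))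

Threshold : List ℚ → ℕ → ℕ → Set
Threshold L d N = (α β : ℚ) → α ∈ L → β ∈ L → (p : ℕ) → Prime p → ¬ (p ∣ d) →
                  (ℓ : ℕ) → 1 ℕ.≤ ℓ → N ℕ.≤ p ^ ℓ →
                  (a : ℕ) → 1 ℕ.≤ a → a ℕ.≤ d → d ∣ (p ^ ℓ ℕ.* a ∸ 1) → Comparison α β a p ℓ (p ^ ℓ)

open import Data.Rational using (_+_; _-_; _≤_)

lemma5 : (αs βs : List ℚ) → All NotNonPosInt αs → All NotNonPosInt βs →
         let d = dAB αs βs
             Good : ℕ → Set
             Good N = (α β : ℚ) → α ∈ αs ++ βs → β ∈ αs ++ βs →
                      (p : ℕ) → Prime p → ¬ (p ∣ d) →
                      (ℓ : ℕ) → 1 ℕ.≤ ℓ → N ℕ.≤ p ^ ℓ →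
                      (a : ℕ) → 1 ℕ.≤ a → a ℕ.≤ d → d ∣ (p ^ ℓ ℕ.* a ∸ 1) →
                      ((ℕtoℚ a ℚ.* α) ⪯ (ℕtoℚ a ℚ.* β)
                        ⇔ (𝔇^ p ℓ α + divℕ (ℤtoℚ (floor (1ℚ - α))) (p ^ ℓ)
                            ≤ 𝔇^ p ℓ β + divℕ (ℤtoℚ (floor (1ℚ - β))) (p ^ ℓ)))
         in Σ ℕ Good × (All InUnit (αs ++ βs) → Good 1)
lemma5 αs βs αs-ok βs-ok = (threshold S , with-bound S (corr≤total L)) , unit-case
  where
  L = αs ++ βs
  d = dAB αs βs
  S = corr-total L
  threshold : ℕ → ℕ
  threshold S = ℕ.suc (S ℕ.* d ℕ.+ S ℕ.* d)
  with-bound : ∀ S → (∀ {x} → x ∈ L → ℤ.∣ corr x ∣ ℕ.≤ S) → Threshold L d (threshold S)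
  with-bound S bound α β α∈ β∈ p p-prime p∤d ℓ _ large a a≥1 a≤d d∣ =
    comparison d S α β (lookup ok α∈) (lookup ok β∈) (den∣lcm L α∈) (den∣lcm L β∈) (bound α∈) (bound β∈)
               p p-prime p∤d ℓ large a a≥1 a≤d d∣
    where ok = ++⁺ αs-ok βs-ok
  -- Parameters in (0, 1] have no corrections, so S = 0 and the threshold is 1.
  unit-case : All InUnit L → Threshold L d 1
  unit-case units = with-bound 0 (λ x∈ → ℕP.≤-reflexive (cong ℤ.∣_∣ (Floor.unit⇒floor≡0 _ (lookup units x∈))))
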